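{- Let $k\ge4$, $G$, $\mathcal S$, $\mathcal Q$, $\alpha$ and the token assignment be as described in the context. If $S$ is a special $3$-star of $\mathcal S$ and $W$ is a star of $\mathcal S$ associated with $S$, then the vertices of $S$ and $W$ receive in total at least $2\alpha+\frac{2-2\alpha}{k-1}$ token.
   Context: $G=(V,E)$ is a simple undirected graph, $k\ge4$ an integer. A star in $G$ is a subgraph that is a single vertex, a single edge, or a tree with exactly one vertex of degree $\ge2$ and all others of degree $1$; an $\ell$-star has exactly $\ell$ vertices, an $\ell^-$-star at most $\ell$, an $\ell^+$-star at least $\ell$. The center of a star is its vertex of maximum degree (in a $2$-star one vertex is designated as center, arbitrarily but fixed); the others are satellites. We write $v_1$-$v_2\ldots v_\ell$ for the star with center $v_1$ and satellites $v_2,\dots,v_\ell$. A $k^-$-star partition of $G$ is a collection of vertex-disjoint $k^-$-stars covering $V$. Operations on a partition $\mathcal S$ (critical vertices are vertices in a $2$-star of $\mathcal S$ or centers of $3$-stars of $\mathcal S$; separate critical vertices lie in different stars of $\mathcal S$): Op.1: for $\{u,v\}\in E$ with $u$ in a $2$-star and $v$ a satellite of a $4^+$-star centered at $c$, replace $\{c,v\}$ by $\{u,v\}$. Op.2: for a star $v_1$-$v_2\ldots v_\ell$ of $\mathcal S$ ($\ell\in\{2,3,4\}$) and pairwise separate critical vertices $w_1,\dots,w_\ell$ outside it with $\{v_j,w_j\}\in E$, replace its edges by $\{v_j,w_j\}$. Op.3: for a $2$- or $3$-star $S=v_1$-$v_2\ldots v_\ell$ and a $2$-star $W=w_1$-$w_2\neq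 S$ with $w_1,w_2$ adjacent to $v_1$: if $k\ge5$ or $\ell=2$ replace $\{w_1,w_2\}$ by $\{w_1,v_1\},\{w_2,v_1\}$; if $k=4,\ell=3$ and some critical $w_3\notin V(S)\cup V(W)$ is adjacent to $v_j$, $j\in\{2,3\}$, replace $\{w_1,w_2\},\{v_1,v_j\}$ by $\{w_1,v_1\},\{w_2,v_1\},\{w_3,v_j\}$. Standing assumptions: $\mathcal S$ is a $k^-$-star partition of $G$ with the minimum possible number of $1$-stars among all $k^-$-star partitions of $G$ and to which none of Operations 1–3 is applicable (equivalently, a possible output of the paper's algorithm). $\mathcal Q$ is a fixed optimal $k^-$-star partition (minimum number of stars), with a fixed center for each of its $2$-stars. A vertex is a center (satellite) of $\mathcal Q$ if it is the center (a satellite) of some star of $\mathcal Q$; an edge of $\mathcal Q$ is an edge of some star of $\mathcal Q$. "Critical" is with respect to $\mathcal S$. Special stars: a $3$-star $S=v_1$-$v_2v_3$ of $\mathcal S$ is special if there is a $2$-star $W=w_1$-$w_2$ of $\mathcal S$ such that (C1) $v_1$ is a satellite of $\mathcal Q$ and $v_2,v_3$ are centers of $\mathcal Q$, and (C2) there are $v_i,v_j\in V(S)$ with $\{v_i,w_1\}$ and $\{v_j,w_2\}$ edges of $\mathcal Q$. A $2$-star $S=v_1$-$v_2$ of $\mathcal S$ is special if $v_1,v_2$ are both satellites of $\mathcal Q$ and either (C3) $k=4$ and there is a $3$-star of $\mathcal S$ with center $w$ such that $\{v_1,w\},\{v_2,w\}$ are edges of $\mathcal Q$, or (C4) there is a $2$-star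 $W=w_1$-$w_2$ of $\mathcal S$ with $\{v_1,w_1\},\{v_2,w_2\}$ edges of $\mathcal Q$. In these cases the star $W$ (in C1–C2 or C4) or the $3$-star (in C3) is said to be associated with $S$. Let $\alpha=\frac{2k-3}{2k^2-4k+1}$. Tokens: the vertex of each $1$-star of $\mathcal Q$ gets $\alpha$. For a $j$-star $v_1$-$v_2\ldots v_j$ of $\mathcal Q$ with $2\le j\le k$: (1) if $v_1$ is critical, $v_1$ gets $\alpha$ and each $v_i$ ($i\ge2$) gets $\frac{1-\alpha}{j-1}$; (2) if $v_1$ is not critical but some satellite is, each $v_i$ ($i\ge2$) gets $\alpha$ and $v_1$ gets $1-(j-1)\alpha$; (3) if no vertex of it is critical, each vertex gets $\frac1j$. -}

module Defs where

open import Data.Nat as ℕ using (ℕ; zero; suc; _≤_; _∸_)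
open import Data.Fin as Fin using (Fin)
open import Data.List using (List; []; _∷_; filter; length)
open import Data.Fin.Base using ()
open import Data.List using (foldr)
open import Data.Fin.Properties using () renaming (_≟_ to _≟ᶠ_)
open import Data.Nat.Properties using () renaming (_≟_ to _≟ⁿ_)
open import Data.Integer using (+_)
open import Data.Rational as ℚ using (ℚ; 1ℚ; 0ℚ)
open import Data.Product using (Σ; ∃; ∃-syntax; _×_; _,_)
open import Data.Sum using (_⊎_)
open import Data.Unit using (⊤)
open import Relation.Nullary using (¬_)
open import Relation.Nullary.Decidable using (_×-dec_)
open import Relation.Binary.PropositionalEquality using (_≡_; _≢_)

allV : (n : ℕ) → List (Fin n)
allV n = Data.List.allFin n
  where import Data.List

record Graph (n : ℕ) : Set₁ where
  field
    Adj    : Fin n → Fin n → Set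
    sym    : ∀ {u v} → Adj u v → Adj v u
    irrefl : ∀ {v} → ¬ Adj v v

module _ {n : ℕ} where

  members : (Fin n → Fin n) → Fin n → List (Fin n)
  members c x = filter (λ v → c v ≟ᶠ x) (allV n)

  size : (Fin n → Fin n) → Fin n → ℕ
  size c x = length (members c x)

-- A star partition is encoded by the map sending every vertex to the center
-- of its star; centers are fixed points, every satellite is adjacent to its
-- center (the star's edges are exactly {v, ctr v}); the center of a 2-star is
-- thereby designated.
record StarPartition {n : ℕ} (G : Graph n) (k : ℕ) : Set where
  open Graph G
  field
    ctr      : Fin n → Fin n
    ctr-idem : ∀ v → ctr (ctr v) ≡ ctr v
    ctr-adj  : ∀ v → v ≢ ctr v → Adj v (ctr v)
    size-≤   : ∀ x → size ctr x ≤ k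

module _ {n : ℕ} {G : Graph n} {k : ℕ} where
  open StarPartition

  numStars : StarPartition G k → ℕ
  numStars P = length (filter (λ x → ctr P x ≟ᶠ x) (allV n))

  numOnes : StarPartition G k → ℕ
  numOnes P = length (filter (λ x → (ctr P x ≟ᶠ x) ×-dec (size (ctr P) x ≟ⁿ 1)) (allV n))

  Optimal : StarPartition G k → Set
  Optimal Q = ∀ (P : StarPartition G k) → numStars Q ≤ numStars P

  MinOnes : StarPartition G k → Set
  MinOnes P = ∀ (P′ : StarPartition G k) → numOnes P ≤ numOnes P′

  Critical : StarPartition G k → Fin n → Set
  Critical P v = size (ctr P) (ctr P v) ≡ 2 ⊎ (ctr P v ≡ v × size (ctr P) v ≡ 3)

  Separate : StarPartition G k → Fin n → Fin n → Set
  Separate P u w = ctr P u ≢ ctr P w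

  open Graph G

  Op1 : StarPartition G k → Set
  Op1 P = Σ (Fin n) λ u → Σ (Fin n) λ v →
    size (ctr P) (ctr P u) ≡ 2 × ctr P v ≢ v × 4 ≤ size (ctr P) (ctr P v) × Adj u v

  -- Operation 2 is applicable (star centered at x; w assigns w_j to v_j)
  Op2 : StarPartition G k → Set
  Op2 P = Σ (Fin n) λ x → ctr P x ≡ x
    × (size (ctr P) x ≡ 2 ⊎ size (ctr P) x ≡ 3 ⊎ size (ctr P) x ≡ 4)
    × Σ (Fin n → Fin n) λ w →
        (∀ v → ctr P v ≡ x → Critical P (w v) × ctr P (w v) ≢ x × Adj v (w v))
      × (∀ v v′ → ctr P v ≡ x → ctr P v′ ≡ x → v ≢ v′ → Separate P (w v) (w v′))

  -- Operation 3 is applicable (S centered at x = v₁, W = w₁-w₂ centered at y = w₁)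
  Op3 : StarPartition G k → Set
  Op3 P = Σ (Fin n) λ x → Σ (Fin n) λ y →
      ctr P x ≡ x × (size (ctr P) x ≡ 2 ⊎ size (ctr P) x ≡ 3)
    × ctr P y ≡ y × size (ctr P) y ≡ 2 × y ≢ x
    × (∀ w → ctr P w ≡ y → Adj w x)
    × (5 ≤ k ⊎ size (ctr P) x ≡ 2
       ⊎ (k ≡ 4 × size (ctr P) x ≡ 3
          × Σ (Fin n) λ w₃ → Σ (Fin n) λ vⱼ →
              Critical P w₃ × ctr P w₃ ≢ x × ctr P w₃ ≢ y
            × ctr P vⱼ ≡ x × vⱼ ≢ x × Adj w₃ vⱼ))

  NoOps : StarPartition G k → Set
  NoOps P = ¬ Op1 P × ¬ Op2 P × ¬ Op3 P

  QCenter : StarPartition G k → Fin n → Set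
  QCenter Q v = ctr Q v ≡ v

  QSatellite : StarPartition G k → Fin n → Set
  QSatellite Q v = ctr Q v ≢ v

  QEdge : StarPartition G k → Fin n → Fin n → Set
  QEdge Q u v = (ctr Q u ≡ v × u ≢ v) ⊎ (ctr Q v ≡ u × u ≢ v)

  -- S has a special 3-star centered at x with associated 2-star W centered at y
  -- (w₁ = y, w₂ = the satellite of W)
  Special3Assoc : (S Q : StarPartition G k) → Fin n → Fin n → Set
  Special3Assoc S Q x y =
      ctr S x ≡ x × size (ctr S) x ≡ 3
    × ctr S y ≡ y × size (ctr S) y ≡ 2
    × QSatellite Q x × (∀ v → ctr S v ≡ x → v ≢ x → QCenter Q v)
    × (Σ (Fin n) λ vᵢ → ctr S vᵢ ≡ x × QEdge Q vᵢ y)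
    × (∀ w₂ → ctr S w₂ ≡ y → w₂ ≢ y → Σ (Fin n) λ vⱼ → ctr S vⱼ ≡ x × QEdge Q vⱼ w₂)

-- α = (2k-3)/(2k²-4k+1); for k ≥ 2 we have 2k²-4k+1 = 1 + 2k(k-2)
α : ℕ → ℚ
α k = (+ (2 ℕ.* k ∸ 3)) ℚ./ suc (2 ℕ.* k ℕ.* (k ∸ 2))

-- token rule for vertex v whose Q-star has center x and j vertices
TokRule : {n : ℕ} {G : Graph n} {k : ℕ} (S Q : StarPartition G k)
          (tok : Fin n → ℚ) (v : Fin n) (j : ℕ) → Set
TokRule S Q tok v zero = ⊤
TokRule {k = k} S Q tok v (suc zero) = tok v ≡ α k
TokRule {k = k} S Q tok v (suc (suc i)) =
  let open StarPartition Q
      x = ctr v in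
    (Critical S x → (v ≡ x → tok v ≡ α k)
                  × (v ≢ x → tok v ≡ (1ℚ ℚ.- α k) ℚ.* ((+ 1) ℚ./ suc i)))
  × (¬ Critical S x → (Σ (Fin _) λ s → ctr s ≡ x × s ≢ x × Critical S s)
       → (v ≡ x → tok v ≡ 1ℚ ℚ.- ((+ suc i) ℚ./ 1) ℚ.* α k)
       × (v ≢ x → tok v ≡ α k))
  × ((∀ s → ctr s ≡ x → ¬ Critical S s) → tok v ≡ (+ 1) ℚ./ suc (suc i))

TokenAssignment : {n : ℕ} {G : Graph n} {k : ℕ} (S Q : StarPartition G k)
                  (tok : Fin n → ℚ) → Set
TokenAssignment S Q tok =
  ∀ v → TokRule S Q tok v (size (StarPartition.ctr Q) (StarPartition.ctr Q v))

starToken : {n : ℕ} {G : Graph n} {k : ℕ} (P : StarPartition G k)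
            (tok : Fin n → ℚ) → Fin n → ℚ
starToken P tok x = foldr (λ v acc → tok v ℚ.+ acc) 0ℚ (members (StarPartition.ctr P) x)

-- 2α + (2-2α)/(k-1), with k-1 = suc (k ∸ 2) for k ≥ 2
bound10 : ℕ → ℚ
bound10 k = ((+ 2) ℚ./ 1) ℚ.* α k
          ℚ.+ (((+ 2) ℚ./ 1) ℚ.- ((+ 2) ℚ./ 1) ℚ.* α k) ℚ.* ((+ 1) ℚ./ suc (k ∸ 2))

{-# OPTIONS --safe #-}
module Submission where

-- Every vertex w of the associated 2-star W is critical and joined by an edge of Q to a vertex v
-- of S.  Either w is a centre of Q, and rule (1) gives it α, or v is the centre of the Q-star of w;
-- then v is a satellite of S (the centre of S is a satellite of Q), hence not critical, and rule (2)
-- gives w the token α.  So W receives 2α.  Put β = (1 - α)/(2(k - 1)).  Each of the four values a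
-- token can take, α, (1 - α)/(j - 1), 1 - (j - 1)α and 1/j for j ≤ k, is at least β, and those a
-- satellite of Q can take are at least 2β.  The centre of S is a satellite of Q, so S receives at
-- least 4β = (2 - 2α)/(k - 1).

open import Algebra.Bundles using (CommutativeMonoid)
open import Data.Empty using (⊥-elim)
open import Data.Fin using (Fin)
open import Data.Fin.Properties using (any?) renaming (_≟_ to _≟ᶠ_)
open import Data.Integer as ℤ using (+_)
import Data.Integer.Properties as ℤP
open import Data.List using (List; []; _∷_; foldr; length)
open import Data.List.Membership.Propositional using (_∈_)
open import Data.List.Membership.Propositional.Properties using (∈-filter⁺; ∈-filter⁻; ∈-allFin; ∈-length)
open import Data.List.Relation.Unary.Any using (here; there)
open import Data.Nat using (ℕ; zero; suc; _+_; _*_; _∸_; _≤_; _≟_; s≤s; z≤n)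
import Data.Nat.Properties as ℕP
open import Data.Nat.Tactic.RingSolver using (solve-∀)
open import Data.Product using (Σ; _×_; _,_; proj₁; proj₂)
open import Data.Rational as ℚ using (ℚ; 0ℚ; 1ℚ; _/_; toℚᵘ) renaming (_≤_ to _≤ℚ_; _+_ to _+ℚ_; _*_ to _*ℚ_; _-_ to _-ℚ_)
import Data.Rational.Properties as ℚP
open import Data.Rational.Solver using (module +-*-Solver)
open import Data.Rational.Unnormalised as ℚᵘ using (mkℚᵘ; *≤*; *≡*) renaming (_≃_ to _≃ᵘ_)
import Data.Rational.Unnormalised.Properties as ℚᵘP
open import Data.Sum using (inj₁; inj₂)
open import Function using (_∘_)
open import Relation.Binary.PropositionalEquality
open import Relation.Nullary using (¬_; Dec; yes; no)
open import Relation.Nullary.Decidable using (_×-dec_; _⊎-dec_; ¬?)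
open import Defs

open import Algebra.Definitions.RawMonoid ℚ.+-0-rawMonoid using () renaming (_×_ to _×ℚ_)
open import Algebra.Properties.Group ℚP.+-0-group using (//-rightDividesʳ)
open import Algebra.Properties.CommutativeSemigroup
  (CommutativeMonoid.commutativeSemigroup ℚP.+-0-commutativeMonoid) using (x∙yz≈y∙xz)

frac : ℕ → ℕ → ℚ
frac a b = + a / suc b

toℚᵘ-frac : ∀ a b → toℚᵘ (frac a b) ≃ᵘ mkℚᵘ (+ a) b
toℚᵘ-frac a b = ℚP.toℚᵘ-fromℚᵘ (mkℚᵘ (+ a) b)

frac-mono-≤ : ∀ a b c d → a * suc d ≤ c * suc b → frac a b ≤ℚ frac c d
frac-mono-≤ a b c d le = ℚP.toℚᵘ-cancel-≤
  (ℚᵘP.≤-respˡ-≃ (ℚᵘP.≃-sym (toℚᵘ-frac a b)) (ℚᵘP.≤-respʳ-≃ (ℚᵘP.≃-sym (toℚᵘ-frac c d))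
    (*≤* (subst₂ ℤ._≤_ (ℤP.pos-* a (suc d)) (ℤP.pos-* c (suc b)) (ℤ.+≤+ le)))))

frac-cong : ∀ a b c d → a * suc d ≡ c * suc b → frac a b ≡ frac c d
frac-cong a b c d eq = ℚP.toℚᵘ-injective (begin
  toℚᵘ (frac a b)  ≈⟨ toℚᵘ-frac a b ⟩
  mkℚᵘ (+ a) b     ≈⟨ *≡* (trans (sym (ℤP.pos-* a (suc d))) (trans (cong +_ eq) (ℤP.pos-* c (suc b)))) ⟩
  mkℚᵘ (+ c) d     ≈⟨ ℚᵘP.≃-sym (toℚᵘ-frac c d) ⟩
  toℚᵘ (frac c d)  ∎)
  where open ℚᵘP.≃-Reasoning

frac-+ : ∀ a b c d → frac a b +ℚ frac c d ≡ frac (a * suc d + c * suc b) (d + b * suc d)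
frac-+ a b c d = ℚP.toℚᵘ-injective (begin
  toℚᵘ (frac a b +ℚ frac c d)             ≈⟨ ℚP.toℚᵘ-homo-+ (frac a b) (frac c d) ⟩
  toℚᵘ (frac a b) ℚᵘ.+ toℚᵘ (frac c d)    ≈⟨ ℚᵘP.+-cong (toℚᵘ-frac a b) (toℚᵘ-frac c d) ⟩
  mkℚᵘ (+ a) b ℚᵘ.+ mkℚᵘ (+ c) d          ≈⟨ *≡* (cong (ℤ._* + suc (d + b * suc d)) numerator) ⟩
  mkℚᵘ (+ (a * suc d + c * suc b)) (d + b * suc d)  ≈⟨ ℚᵘP.≃-sym (toℚᵘ-frac _ _) ⟩
  toℚᵘ (frac (a * suc d + c * suc b) (d + b * suc d)) ∎)
  where
  open ℚᵘP.≃-Reasoning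
  numerator : + a ℤ.* + suc d ℤ.+ + c ℤ.* + suc b ≡ + (a * suc d + c * suc b)
  numerator = trans (cong₂ ℤ._+_ (sym (ℤP.pos-* a (suc d))) (sym (ℤP.pos-* c (suc b))))
                    (sym (ℤP.pos-+ (a * suc d) (c * suc b)))

frac-* : ∀ a b c d → frac a b *ℚ frac c d ≡ frac (a * c) (d + b * suc d)
frac-* a b c d = ℚP.toℚᵘ-injective (begin
  toℚᵘ (frac a b *ℚ frac c d)             ≈⟨ ℚP.toℚᵘ-homo-* (frac a b) (frac c d) ⟩
  toℚᵘ (frac a b) ℚᵘ.* toℚᵘ (frac c d)    ≈⟨ ℚᵘP.*-cong (toℚᵘ-frac a b) (toℚᵘ-frac c d) ⟩
  mkℚᵘ (+ a) b ℚᵘ.* mkℚᵘ (+ c) d          ≈⟨ *≡* (cong (ℤ._* + suc (d + b * suc d)) (sym (ℤP.pos-* a c))) ⟩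
  mkℚᵘ (+ (a * c)) (d + b * suc d)        ≈⟨ ℚᵘP.≃-sym (toℚᵘ-frac _ _) ⟩
  toℚᵘ (frac (a * c) (d + b * suc d))     ∎)
  where open ℚᵘP.≃-Reasoning

frac-+-frac : ∀ a b d → frac a d +ℚ frac b d ≡ frac (a + b) d
frac-+-frac a b d =
  trans (frac-+ a d b d) (frac-cong (a * suc d + b * suc d) (d + d * suc d) (a + b) d (lemma a b d))
  where
  lemma : ∀ a b d → (a * suc d + b * suc d) * suc d ≡ (a + b) * suc (d + d * suc d)
  lemma = solve-∀

m+r≡n⇒m≤n : ∀ {m n} r → m + r ≡ n → m ≤ n
m+r≡n⇒m≤n {m} r refl = ℕP.m≤m+n m r

-- (1 - α k)/(2(k - 1)), over the denominator of α k
β : ℕ → ℚ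
β k = frac (k ∸ 2) (2 * k * (k ∸ 2))

-- k = 2 + c, so that k ∸ 2 reduces to c in α, β and bound10.
module _ (c : ℕ) where

  private
    k d : ℕ
    k = 2 + c
    d = 2 * k * c

  α≡frac : α k ≡ frac (1 + 2 * c) d
  α≡frac = cong (λ a → frac a d) (trans (cong (_∸ 3) (lemma c)) (ℕP.m+n∸m≡n 3 (1 + 2 * c)))
    where
    lemma : ∀ c → 2 * (2 + c) ≡ 3 + (1 + 2 * c)
    lemma = solve-∀

  1-α≡frac : 1ℚ -ℚ α k ≡ frac (2 * (1 + c) * c) d
  1-α≡frac = begin
    1ℚ -ℚ α k                                   ≡⟨ cong (_-ℚ α k) 1≡ ⟩
    (frac (2 * (1 + c) * c) d +ℚ α k) -ℚ α k    ≡⟨ //-rightDividesʳ (α k) (frac (2 * (1 + c) * c) d) ⟩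
    frac (2 * (1 + c) * c) d                    ∎
    where
    open ≡-Reasoning
    lemma : ∀ c → 1 * suc (2 * (2 + c) * c) ≡ (2 * (1 + c) * c + (1 + 2 * c)) * 1
    lemma = solve-∀
    1≡ : 1ℚ ≡ frac (2 * (1 + c) * c) d +ℚ α k
    1≡ = begin
      frac 1 0
        ≡⟨ frac-cong 1 0 (2 * (1 + c) * c + (1 + 2 * c)) d (lemma c) ⟩
      frac (2 * (1 + c) * c + (1 + 2 * c)) d
        ≡⟨ sym (frac-+-frac (2 * (1 + c) * c) (1 + 2 * c) d) ⟩
      frac (2 * (1 + c) * c) d +ℚ frac (1 + 2 * c) d
        ≡⟨ cong (frac (2 * (1 + c) * c) d +ℚ_) (sym α≡frac) ⟩
      frac (2 * (1 + c) * c) d +ℚ α k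
        ∎

  0≤α : 0ℚ ≤ℚ α k
  0≤α = frac-mono-≤ 0 0 (2 * k ∸ 3) d z≤n

  0≤β : 0ℚ ≤ℚ β k
  0≤β = frac-mono-≤ 0 0 c d z≤n

  0≤1-α : 0ℚ ≤ℚ 1ℚ -ℚ α k
  0≤1-α = subst (0ℚ ≤ℚ_) (sym 1-α≡frac) (frac-mono-≤ 0 0 (2 * (1 + c) * c) d z≤n)

  β≤β+β : β k ≤ℚ β k +ℚ β k
  β≤β+β = subst (_≤ℚ β k +ℚ β k) (ℚP.+-identityʳ (β k)) (ℚP.+-monoʳ-≤ (β k) 0≤β)

  β+β≤α : β k +ℚ β k ≤ℚ α k
  β+β≤α = subst₂ _≤ℚ_ (sym (frac-+-frac c c d)) (sym α≡frac)
    (frac-mono-≤ (c + c) d (1 + 2 * c) d (ℕP.*-monoˡ-≤ (suc d) (m+r≡n⇒m≤n 1 (lemma c))))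
    where
    lemma : ∀ c → c + c + 1 ≡ 1 + 2 * c
    lemma = solve-∀

  β≤α : β k ≤ℚ α k
  β≤α = ℚP.≤-trans β≤β+β β+β≤α

  [1-α]/[k-1]≡β+β : (1ℚ -ℚ α k) *ℚ frac 1 c ≡ β k +ℚ β k
  [1-α]/[k-1]≡β+β = begin
    (1ℚ -ℚ α k) *ℚ frac 1 c                           ≡⟨ cong (_*ℚ frac 1 c) 1-α≡frac ⟩
    frac (2 * (1 + c) * c) d *ℚ frac 1 c              ≡⟨ frac-* (2 * (1 + c) * c) d 1 c ⟩
    frac (2 * (1 + c) * c * 1) (c + d * suc c)
      ≡⟨ frac-cong (2 * (1 + c) * c * 1) (c + d * suc c) (c + c) d (lemma c) ⟩
    frac (c + c) d                                    ≡⟨ sym (frac-+-frac c c d) ⟩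
    β k +ℚ β k                                        ∎
    where
    open ≡-Reasoning
    lemma : ∀ c → 2 * (1 + c) * c * 1 * suc (2 * (2 + c) * c)
                ≡ (c + c) * suc (c + 2 * (2 + c) * c * suc c)
    lemma = solve-∀

  β+β≤[1-α]/[j-1] : ∀ {i} → i ≤ c → β k +ℚ β k ≤ℚ (1ℚ -ℚ α k) *ℚ frac 1 i
  β+β≤[1-α]/[j-1] {i} i≤c = subst (_≤ℚ (1ℚ -ℚ α k) *ℚ frac 1 i) [1-α]/[k-1]≡β+β
    (ℚP.*-monoˡ-≤-nonNeg (1ℚ -ℚ α k) {{ℚ.nonNegative 0≤1-α}}
      (frac-mono-≤ 1 c 1 i (ℕP.*-monoʳ-≤ 1 (s≤s i≤c))))

  β+[k-1]α≡1 : β k +ℚ frac (suc c) 0 *ℚ α k ≡ 1ℚ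
  β+[k-1]α≡1 = begin
    β k +ℚ frac (suc c) 0 *ℚ α k
      ≡⟨ cong (λ a → β k +ℚ frac (suc c) 0 *ℚ a) α≡frac ⟩
    β k +ℚ frac (suc c) 0 *ℚ frac (1 + 2 * c) d
      ≡⟨ cong (β k +ℚ_) (frac-* (suc c) 0 (1 + 2 * c) d) ⟩
    β k +ℚ frac (suc c * (1 + 2 * c)) (d + 0)
      ≡⟨ cong (λ e → β k +ℚ frac (suc c * (1 + 2 * c)) e) (ℕP.+-identityʳ d) ⟩
    β k +ℚ frac (suc c * (1 + 2 * c)) d
      ≡⟨ frac-+-frac c (suc c * (1 + 2 * c)) d ⟩
    frac (c + suc c * (1 + 2 * c)) d
      ≡⟨ frac-cong (c + suc c * (1 + 2 * c)) d 1 0 (lemma c) ⟩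
    1ℚ
      ∎
    where
    open ≡-Reasoning
    lemma : ∀ c → (c + suc c * (1 + 2 * c)) * 1 ≡ 1 * suc (2 * (2 + c) * c)
    lemma = solve-∀

  β≤1-[j-1]α : ∀ {i} → i ≤ c → β k ≤ℚ 1ℚ -ℚ frac (suc i) 0 *ℚ α k
  β≤1-[j-1]α {i} i≤c = begin
    β k                                   ≡⟨ sym (//-rightDividesʳ (frac (suc c) 0 *ℚ α k) (β k)) ⟩
    (β k +ℚ frac (suc c) 0 *ℚ α k) -ℚ frac (suc c) 0 *ℚ α k  ≡⟨ cong (_-ℚ frac (suc c) 0 *ℚ α k) β+[k-1]α≡1 ⟩
    1ℚ -ℚ frac (suc c) 0 *ℚ α k          ≤⟨ ℚP.+-monoʳ-≤ 1ℚ (ℚP.neg-antimono-≤ multiple-≤) ⟩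
    1ℚ -ℚ frac (suc i) 0 *ℚ α k          ∎
    where
    open ℚP.≤-Reasoning
    multiple-≤ : frac (suc i) 0 *ℚ α k ≤ℚ frac (suc c) 0 *ℚ α k
    multiple-≤ = ℚP.*-monoʳ-≤-nonNeg (α k) {{ℚ.nonNegative 0≤α}}
      (frac-mono-≤ (suc i) 0 (suc c) 0 (ℕP.*-monoˡ-≤ 1 (s≤s i≤c)))

  β+β≤1/j : ∀ {i} → i ≤ c → β k +ℚ β k ≤ℚ frac 1 (suc i)
  β+β≤1/j {i} i≤c = begin
    β k +ℚ β k        ≡⟨ frac-+-frac c c d ⟩
    frac (c + c) d    ≤⟨ frac-mono-≤ (c + c) d 1 (suc c) (m+r≡n⇒m≤n 1 (lemma c)) ⟩
    frac 1 (suc c)    ≤⟨ frac-mono-≤ 1 (suc c) 1 (suc i) (ℕP.*-monoʳ-≤ 1 (s≤s (s≤s i≤c))) ⟩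
    frac 1 (suc i)    ∎
    where
    open ℚP.≤-Reasoning
    lemma : ∀ c → (c + c) * suc (suc c) + 1 ≡ 1 * suc (2 * (2 + c) * c)
    lemma = solve-∀

  bound10≡ : bound10 k ≡ (β k +ℚ 3 ×ℚ β k) +ℚ 2 ×ℚ α k
  bound10≡ = begin
    bound10 k                                        ≡⟨ regroup (α k) (frac 1 c) ⟩
    2 ×ℚ ((1ℚ -ℚ α k) *ℚ frac 1 c) +ℚ 2 ×ℚ α k       ≡⟨ cong (λ s → 2 ×ℚ s +ℚ 2 ×ℚ α k) [1-α]/[k-1]≡β+β ⟩
    2 ×ℚ (β k +ℚ β k) +ℚ 2 ×ℚ α k                    ≡⟨ cong (_+ℚ 2 ×ℚ α k) (four-β (β k)) ⟩
    (β k +ℚ 3 ×ℚ β k) +ℚ 2 ×ℚ α k                    ∎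
    where
    open ≡-Reasoning
    open +-*-Solver
    regroup : ∀ a r → frac 2 0 *ℚ a +ℚ (frac 2 0 -ℚ frac 2 0 *ℚ a) *ℚ r
                    ≡ 2 ×ℚ ((1ℚ -ℚ a) *ℚ r) +ℚ 2 ×ℚ a
    regroup = solve 2 (λ a r →
      con (frac 2 0) :* a :+ (con (frac 2 0) :- con (frac 2 0) :* a) :* r
        := ((con 1ℚ :- a) :* r :+ ((con 1ℚ :- a) :* r :+ con 0ℚ)) :+ (a :+ (a :+ con 0ℚ))) refl
    four-β : ∀ b → 2 ×ℚ (b +ℚ b) ≡ b +ℚ 3 ×ℚ b
    four-β = solve 1 (λ b → (b :+ b) :+ ((b :+ b) :+ con 0ℚ) := b :+ (b :+ (b :+ (b :+ con 0ℚ)))) refl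

module _ {A : Set} where

  sumOver : (A → ℚ) → List A → ℚ
  sumOver f = foldr (λ v acc → f v +ℚ acc) 0ℚ

  sumOver-≡-multiple : ∀ {f a} xs → (∀ {u} → u ∈ xs → f u ≡ a) → sumOver f xs ≡ length xs ×ℚ a
  sumOver-≡-multiple []       _ = refl
  sumOver-≡-multiple (x ∷ xs) f≡a = cong₂ _+ℚ_ (f≡a (here refl)) (sumOver-≡-multiple xs (f≡a ∘ there))

  multiple-≤-sumOver : ∀ {f a} xs → (∀ {u} → u ∈ xs → a ≤ℚ f u) → length xs ×ℚ a ≤ℚ sumOver f xs
  multiple-≤-sumOver []       _ = ℚP.≤-refl
  multiple-≤-sumOver (x ∷ xs) a≤f = ℚP.+-mono-≤ (a≤f (here refl)) (multiple-≤-sumOver xs (a≤f ∘ there))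

  surplus+multiple-≤-sumOver : ∀ {f a e x} xs → (∀ {u} → u ∈ xs → a ≤ℚ f u) → x ∈ xs → e +ℚ a ≤ℚ f x
                             → e +ℚ length xs ×ℚ a ≤ℚ sumOver f xs
  surplus+multiple-≤-sumOver {f} {a} {e} (y ∷ ys) a≤f (here refl) e+a≤fx = begin
    e +ℚ (a +ℚ length ys ×ℚ a)   ≡⟨ sym (ℚP.+-assoc e a _) ⟩
    (e +ℚ a) +ℚ length ys ×ℚ a   ≤⟨ ℚP.+-mono-≤ e+a≤fx (multiple-≤-sumOver ys (a≤f ∘ there)) ⟩
    f y +ℚ sumOver f ys          ∎
    where open ℚP.≤-Reasoning
  surplus+multiple-≤-sumOver {f} {a} {e} (y ∷ ys) a≤f (there x∈ys) e+a≤fx = begin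
    e +ℚ (a +ℚ length ys ×ℚ a)   ≡⟨ x∙yz≈y∙xz e a _ ⟩
    a +ℚ (e +ℚ length ys ×ℚ a)   ≤⟨ ℚP.+-mono-≤ (a≤f (here refl))
                                      (surplus+multiple-≤-sumOver {e = e} ys (a≤f ∘ there) x∈ys e+a≤fx) ⟩
    f y +ℚ sumOver f ys          ∎
    where open ℚP.≤-Reasoning

module _ {n : ℕ} where

  ∈-members-ctr : ∀ (f : Fin n → Fin n) v → v ∈ members f (f v)
  ∈-members-ctr f v = ∈-filter⁺ (λ u → f u ≟ᶠ f v) (∈-allFin v) refl

  ∈-members⁻ : ∀ {f : Fin n → Fin n} {x u} → u ∈ members f x → f u ≡ x
  ∈-members⁻ {f} {x} = proj₂ ∘ ∈-filter⁻ (λ u → f u ≟ᶠ x) {xs = allV n}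

module _ {n : ℕ} {G : Graph n} {k : ℕ} where
  open StarPartition

  critical? : (P : StarPartition G k) → ∀ v → Dec (Critical P v)
  critical? P v = (size (ctr P) (ctr P v) ≟ 2) ⊎-dec ((ctr P v ≟ᶠ v) ×-dec (size (ctr P) v ≟ 3))

  3-star-satellite-noncritical : (P : StarPartition G k) → ∀ {x v} → ctr P v ≡ x → size (ctr P) x ≡ 3 → v ≢ x
                               → ¬ Critical P v
  3-star-satellite-noncritical P v→x x-3 v≢x (inj₁ in-2-star)
    with trans (sym x-3) (subst (λ z → size (ctr P) z ≡ 2) v→x in-2-star)
  ... | ()
  3-star-satellite-noncritical P v→x x-3 v≢x (inj₂ (v-center , _)) = v≢x (trans (sym v-center) v→x)

  CriticalSatellite : (S Q : StarPartition G k) → Fin n → Set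
  CriticalSatellite S Q x = Σ (Fin n) λ s → ctr Q s ≡ x × s ≢ x × Critical S s

  criticalSatellite? : (S Q : StarPartition G k) → ∀ x → Dec (CriticalSatellite S Q x)
  criticalSatellite? S Q x = any? (λ s → (ctr Q s ≟ᶠ x) ×-dec ¬? (s ≟ᶠ x) ×-dec critical? S s)

  no-critical-vertex : (S Q : StarPartition G k) → ∀ {x} → ¬ Critical S x → ¬ CriticalSatellite S Q x
                     → ∀ s → ctr Q s ≡ x → ¬ Critical S s
  no-critical-vertex S Q {x} x-noncritical no-satellite s s→x s-critical with s ≟ᶠ x
  ... | yes refl = x-noncritical s-critical
  ... | no s≢x   = no-satellite (s , s→x , s≢x , s-critical)

module TokenRules {n : ℕ} {G : Graph n} {k : ℕ} {S Q : StarPartition G k} {tok : Fin n → ℚ}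
                  (ta : TokenAssignment S Q tok) where
  open StarPartition

  data RuleView (v : Fin n) : Set where
    singleton : tok v ≡ α k → RuleView v
    rules     : ∀ i → 2 + i ≤ k → TokRule S Q tok v (2 + i) → RuleView v

  ruleView : ∀ v → RuleView v
  ruleView v = view _ refl (ta v)
    where
    view : ∀ j → size (ctr Q) (ctr Q v) ≡ j → TokRule S Q tok v j → RuleView v
    view zero          size≡0 _    = ⊥-elim (ℕP.<⇒≢ (∈-length (∈-members-ctr (ctr Q) v)) (sym size≡0))
    view (suc zero)    _      tok≡ = singleton tok≡
    view (suc (suc i)) size≡  rule = rules i (subst (_≤ k) size≡ (size-≤ Q (ctr Q v))) rule

  critical-QCenter⇒tok≡α : ∀ {v} → QCenter Q v → Critical S v → tok v ≡ α k
  critical-QCenter⇒tok≡α {v} center critical = by-rule₁ (ruleView v)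
    where
    by-rule₁ : RuleView v → tok v ≡ α k
    by-rule₁ (singleton tok≡)        = tok≡
    by-rule₁ (rules _ _ (rule₁ , _)) = proj₁ (rule₁ (subst (Critical S) (sym center) critical)) (sym center)

  critical-QSatellite⇒tok≡α : ∀ {v} → QSatellite Q v → Critical S v → ¬ Critical S (ctr Q v) → tok v ≡ α k
  critical-QSatellite⇒tok≡α {v} satellite critical center-noncritical = by-rule₂ (ruleView v)
    where
    by-rule₂ : RuleView v → tok v ≡ α k
    by-rule₂ (singleton tok≡)            = tok≡
    by-rule₂ (rules _ _ (_ , rule₂ , _)) =
      proj₂ (rule₂ center-noncritical (v , refl , satellite ∘ sym , critical)) (satellite ∘ sym)

  data TokenValue (v : Fin n) : Set where
    α-token   : tok v ≡ α k → TokenValue v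
    share     : ∀ {i} → 2 + i ≤ k → QSatellite Q v → tok v ≡ (1ℚ -ℚ α k) *ℚ frac 1 i → TokenValue v
    remainder : ∀ {i} → 2 + i ≤ k → QCenter Q v → tok v ≡ 1ℚ -ℚ frac (suc i) 0 *ℚ α k → TokenValue v
    uniform   : ∀ {i} → 2 + i ≤ k → tok v ≡ frac 1 (suc i) → TokenValue v

  tokenValue : ∀ v → TokenValue v
  tokenValue v =
    classify (ruleView v) (critical? S (ctr Q v)) (criticalSatellite? S Q (ctr Q v)) (v ≟ᶠ ctr Q v)
    where
    classify : RuleView v → Dec (Critical S (ctr Q v)) → Dec (CriticalSatellite S Q (ctr Q v))
             → Dec (v ≡ ctr Q v) → TokenValue v
    classify (singleton tok≡) _ _ _ = α-token tok≡
    classify (rules _ j≤k (rule₁ , _)) (yes center-critical) _ (yes v≡x) =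
      α-token (proj₁ (rule₁ center-critical) v≡x)
    classify (rules _ j≤k (rule₁ , _)) (yes center-critical) _ (no v≢x) =
      share j≤k (v≢x ∘ sym) (proj₂ (rule₁ center-critical) v≢x)
    classify (rules _ j≤k (_ , rule₂ , _)) (no center-noncritical) (yes critical-satellite) (yes v≡x) =
      remainder j≤k (sym v≡x) (proj₁ (rule₂ center-noncritical critical-satellite) v≡x)
    classify (rules _ j≤k (_ , rule₂ , _)) (no center-noncritical) (yes critical-satellite) (no v≢x) =
      α-token (proj₂ (rule₂ center-noncritical critical-satellite) v≢x)
    classify (rules _ j≤k (_ , _ , rule₃)) (no center-noncritical) (no no-satellite) _ =
      uniform j≤k (rule₃ (no-critical-vertex S Q center-noncritical no-satellite))

module _ {n : ℕ} {G : Graph n} {c : ℕ} {S Q : StarPartition G (2 + c)} {tok : Fin n → ℚ}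
         (ta : TokenAssignment S Q tok) where
  open StarPartition
  open TokenRules ta

  QSatellite⇒β+β≤tok : ∀ {v} → QSatellite Q v → β (2 + c) +ℚ β (2 + c) ≤ℚ tok v
  QSatellite⇒β+β≤tok {v} satellite = bound (tokenValue v)
    where
    bound : TokenValue v → β (2 + c) +ℚ β (2 + c) ≤ℚ tok v
    bound (α-token tok≡)                 = subst (_ ≤ℚ_) (sym tok≡) (β+β≤α c)
    bound (share (s≤s (s≤s i≤c)) _ tok≡) = subst (_ ≤ℚ_) (sym tok≡) (β+β≤[1-α]/[j-1] c i≤c)
    bound (remainder _ center _)         = ⊥-elim (satellite center)
    bound (uniform (s≤s (s≤s i≤c)) tok≡) = subst (_ ≤ℚ_) (sym tok≡) (β+β≤1/j c i≤c)

  β≤tok : ∀ v → β (2 + c) ≤ℚ tok v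
  β≤tok v = bound (tokenValue v)
    where
    bound : TokenValue v → β (2 + c) ≤ℚ tok v
    bound (α-token tok≡)                     = subst (_ ≤ℚ_) (sym tok≡) (β≤α c)
    bound (share _ satellite _)              = ℚP.≤-trans (β≤β+β c) (QSatellite⇒β+β≤tok satellite)
    bound (remainder (s≤s (s≤s i≤c)) _ tok≡) = subst (_ ≤ℚ_) (sym tok≡) (β≤1-[j-1]α c i≤c)
    bound (uniform (s≤s (s≤s i≤c)) tok≡)     = subst (_ ≤ℚ_) (sym tok≡) (ℚP.≤-trans (β≤β+β c) (β+β≤1/j c i≤c))

  special-3-star-token : ∀ {x y} → Special3Assoc S Q x y → β (2 + c) +ℚ 3 ×ℚ β (2 + c) ≤ℚ starToken S tok x
  special-3-star-token {x} (x-center , x-3 , _ , _ , x-satellite , _) =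
    subst (λ m → β (2 + c) +ℚ m ×ℚ β (2 + c) ≤ℚ starToken S tok x) x-3
      (surplus+multiple-≤-sumOver {e = β (2 + c)} (members (ctr S) x) (λ {u} _ → β≤tok u) x∈S
        (QSatellite⇒β+β≤tok x-satellite))
    where
    x∈S : x ∈ members (ctr S) x
    x∈S = subst (λ z → x ∈ members (ctr S) z) x-center (∈-members-ctr (ctr S) x)

module _ {n : ℕ} {G : Graph n} {k : ℕ} {S Q : StarPartition G k} {tok : Fin n → ℚ}
         (ta : TokenAssignment S Q tok) where
  open StarPartition
  open TokenRules ta

  QEdge-to-3-star⇒tok≡α : ∀ {x v w} → QSatellite Q x → ctr S v ≡ x → size (ctr S) x ≡ 3 → Critical S w
                        → QEdge Q v w → tok w ≡ α k
  QEdge-to-3-star⇒tok≡α {v = v} {w} _ _ _ w-critical (inj₁ (v→w , _)) =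
    critical-QCenter⇒tok≡α (trans (cong (ctr Q) (sym v→w)) (trans (ctr-idem Q v) v→w)) w-critical
  QEdge-to-3-star⇒tok≡α {v = v} {w} x-satellite v→x x-3 w-critical (inj₂ (w→v , v≢w)) =
    critical-QSatellite⇒tok≡α (v≢w ∘ trans (sym w→v)) w-critical
      (subst (¬_ ∘ Critical S) (sym w→v) v-noncritical)
    where
    v-center : QCenter Q v
    v-center = trans (cong (ctr Q) (sym w→v)) (trans (ctr-idem Q w) w→v)
    v-noncritical : ¬ Critical S v
    v-noncritical =
      3-star-satellite-noncritical S v→x x-3 (λ v≡x → x-satellite (subst (QCenter Q) v≡x v-center))

  associated-2-star-tok≡α : ∀ {x y} → Special3Assoc S Q x y → ∀ {u} → u ∈ members (ctr S) y → tok u ≡ α k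
  associated-2-star-tok≡α {y = y}
    (_ , x-3 , _ , y-2 , x-satellite , _ , (vᵢ , vᵢ→x , vᵢ-y) , satellite-edges) {u} u∈W = tok≡α (u ≟ᶠ y)
    where
    u→y : ctr S u ≡ y
    u→y = ∈-members⁻ u∈W
    u-critical : Critical S u
    u-critical = inj₁ (subst (λ z → size (ctr S) z ≡ 2) (sym u→y) y-2)
    tok≡α : Dec (u ≡ y) → tok u ≡ α k
    tok≡α (yes refl) = QEdge-to-3-star⇒tok≡α x-satellite vᵢ→x x-3 u-critical vᵢ-y
    tok≡α (no u≢y) with satellite-edges u u→y u≢y
    ... | vⱼ , vⱼ→x , vⱼ-u = QEdge-to-3-star⇒tok≡α x-satellite vⱼ→x x-3 u-critical vⱼ-u

  associated-2-star-token : ∀ {x y} → Special3Assoc S Q x y → starToken S tok y ≡ 2 ×ℚ α k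
  associated-2-star-token {y = y} sp@(_ , _ , _ , y-2 , _) =
    trans (sumOver-≡-multiple (members (ctr S) y) (associated-2-star-tok≡α sp)) (cong (_×ℚ α k) y-2)

lemma10 : ∀ {n : ℕ} (G : Graph n) (k : ℕ) → 4 ≤ k
          → (S Q : StarPartition G k)
          → MinOnes S → NoOps S → Optimal Q
          → (tok : Fin n → ℚ) → TokenAssignment S Q tok
          → (x y : Fin n) → Special3Assoc S Q x y
          → bound10 k ≤ℚ (starToken S tok x +ℚ starToken S tok y)
lemma10 G (suc (suc c)) (s≤s (s≤s _)) S Q _ _ _ tok ta x y sp = begin
  bound10 (2 + c)
    ≡⟨ bound10≡ c ⟩
  (β (2 + c) +ℚ 3 ×ℚ β (2 + c)) +ℚ 2 ×ℚ α (2 + c)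
    ≤⟨ ℚP.+-mono-≤ (special-3-star-token ta sp) (ℚP.≤-reflexive (sym (associated-2-star-token ta sp))) ⟩
  starToken S tok x +ℚ starToken S tok y
    ∎
  where open ℚP.≤-Reasoning
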